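{- Let $A\subseteq U$ with $|A|\ge\ell$ and let $C\subset A$. Let $h$ be chosen uniformly at random from a family $\mathcal H$ of $\varepsilon$-$\ell$-min-wise independent hash functions on $U$, and let $\mathrm{Smallest}(H(A,h),\ell)$ be the set of the $\ell$ smallest pairs $(h(x),x)$, $x\in A$. Then the event $\mathcal F=\{\mathrm{Smallest}(H(A,h),\ell)\subseteq H(C,h)\}$ has probability at most $(1+\varepsilon)\left(\frac{|C|}{|A|}\right)^{\ell}$.
   Context: $U=\{1,\dots,N\}$. For $h$ and $X\subseteq U$, $H(X,h)=\{(h(x),x):x\in X\}$, with pairs ordered lexicographically: $(h(x),x)\le(h(y),y)$ iff $h(x)<h(y)$ or ($h(x)=h(y)$ and $x\le y$). A family $\mathcal H$ is $\varepsilon$-$d$-min-wise independent ($0<\varepsilon<1$, $2\le d\le N$) if for every $A\subseteq U$ and every $X\subseteq A$ with $|X|=d$, $\Pr_{h\in\mathcal H}[\max h(X)\le\min h(A\setminus X)]=(1\pm\varepsilon)/\binom{|A|}{|X|}$. -}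

module Defs where

open import Data.Bool using (Bool; true; false; _∧_; _∨_; _≟_)
open import Data.Nat as ℕ using (ℕ; zero; suc; _<ᵇ_; _≡ᵇ_; _≤ᵇ_)
open import Data.Fin using (Fin; toℕ)
open import Data.Fin.Subset using (Subset; _─_)
open import Data.Fin.Subset.Properties using (_∈?_)
open import Data.List using (List; []; _∷_; filter; length)
open import Data.List.Base using (allFin)
open import Data.Integer using (+_)
open import Data.Rational using (ℚ; _/_; _*_; 1ℚ; 0ℚ)
open import Relation.Nullary using (does)

-- The universe U = {1,…,N} is modelled by Fin N.
-- A hash function maps U to ℕ.
Hash : ℕ → Set
Hash N = Fin N → ℕ

-- A family of hash functions is a finite (multi)set, given as a list;
-- h is chosen uniformly at random from it.
Family : ℕ → Set
Family N = List (Hash N)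

-- Rational m / n for naturals (0 when n = 0; only used with n ≠ 0).
_÷ℕ_ : ℕ → ℕ → ℚ
m ÷ℕ zero  = 0ℚ
m ÷ℕ suc n = (+ m) / suc n

_^ℚ_ : ℚ → ℕ → ℚ
q ^ℚ zero  = 1ℚ
q ^ℚ suc k = q * (q ^ℚ k)

countH : ∀ {N} → (Hash N → Bool) → Family N → ℕ
countH E H = length (filter (λ h → E h ≟ true) H)

Pr : ∀ {N} → Family N → (Hash N → Bool) → ℚ
Pr H E = countH E H ÷ℕ length H

all : ∀ {a} {A : Set a} → (A → Bool) → List A → Bool
all p []       = true
all p (x ∷ xs) = p x ∧ all p xs

members : ∀ {N} → Subset N → List (Fin N)
members {N} X = filter (_∈? X) (allFin N)

-- Event  max h(X) ≤ min h(A∖X)  (true when either side is empty).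
maxLeMin : ∀ {N} → Hash N → (A X : Subset N) → Bool
maxLeMin h A X = all (λ x → all (λ y → h x ≤ᵇ h y) (members (A ─ X))) (members X)

lexLt : ∀ {N} → Hash N → Fin N → Fin N → Bool
lexLt h y x = (h y <ᵇ h x) ∨ ((h y ≡ᵇ h x) ∧ (toℕ y <ᵇ toℕ x))

rank : ∀ {N} → Hash N → Subset N → Fin N → ℕ
rank h A x = length (filter (λ y → lexLt h y x ≟ true) (members A))

-- Smallest(H(A,h),ℓ), represented by the set of x ∈ A whose pair (h(x),x)
-- is among the ℓ smallest pairs of H(A,h), i.e. has rank < ℓ.
smallestIn : ∀ {N} → Hash N → (A C : Subset N) → ℕ → Bool
smallestIn h A C ℓ = all (λ x → (ℓ ≤ᵇ rank h A x) ∨ does (x ∈? C)) (members A)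

module Submission where

-- If the ℓ smallest pairs of H(A,h) all come from C, their first components form an
-- ℓ-subset X of C with max h(X) ≤ min h(A∖X).  A union bound over the (|C| choose ℓ)
-- such subsets, each of probability at most (1+ε)/(|A| choose ℓ), gives
-- Pr[F] ≤ (1+ε)·(|C| choose ℓ)/(|A| choose ℓ), and for c ≤ a
-- (c choose ℓ)/(a choose ℓ) = ∏_{i<ℓ} (c−i)/(a−i) ≤ (c/a)^ℓ.

module NaturalQuotients where

  open import Defs
  open import Data.Nat as ℕ using (ℕ; zero; suc; NonZero)
  import Data.Nat.Properties as ℕ
  open import Data.Integer as ℤ using (+_; +≤+)
  import Data.Integer.Properties as ℤ
  open import Data.Rational using (0ℚ; _+_; _*_; _≤_; toℚᵘ)
  open import Data.Rational.Properties
  import Data.Rational.Unnormalised as ℚᵘ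
  import Data.Rational.Unnormalised.Properties as ℚᵘ
  open import Data.List using (List; []; _∷_; length)
  open import Data.List.Relation.Unary.All using (All; []; _∷_)
  open import Data.Nat.ListAction using (sum)
  open import Relation.Binary.PropositionalEquality
  open import Data.Integer.Tactic.RingSolver using (solve-∀)

  toℚᵘ-÷ℕ : ∀ m d → toℚᵘ (m ÷ℕ suc d) ℚᵘ.≃ ℚᵘ.mkℚᵘ (+ m) d
  toℚᵘ-÷ℕ m d = toℚᵘ-fromℚᵘ (ℚᵘ.mkℚᵘ (+ m) d)

  ÷ℕ-≤-cross : ∀ {m n d e} .{{_ : NonZero d}} .{{_ : NonZero e}} →
               m ℕ.* e ℕ.≤ n ℕ.* d → m ÷ℕ d ≤ n ÷ℕ e
  ÷ℕ-≤-cross {m} {n} {suc d} {suc e} me≤nd = toℚᵘ-cancel-≤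
    (ℚᵘ.≤-respʳ-≃ (ℚᵘ.≃-sym (toℚᵘ-÷ℕ n e)) (ℚᵘ.≤-respˡ-≃ (ℚᵘ.≃-sym (toℚᵘ-÷ℕ m d))
      (ℚᵘ.*≤* (subst₂ ℤ._≤_ (ℤ.pos-* m (suc e)) (ℤ.pos-* n (suc d)) (+≤+ me≤nd)))))

  ÷ℕ-monoˡ-≤ : ∀ {m n} d → m ℕ.≤ n → m ÷ℕ d ≤ n ÷ℕ d
  ÷ℕ-monoˡ-≤ zero    _   = ≤-refl
  ÷ℕ-monoˡ-≤ {m} {n} (suc d) m≤n = ÷ℕ-≤-cross {m} {n} (ℕ.*-monoˡ-≤ (suc d) m≤n)

  0÷ℕn≡0 : ∀ n → 0 ÷ℕ n ≡ 0ℚ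
  0÷ℕn≡0 zero    = refl
  0÷ℕn≡0 (suc n) = toℚᵘ-injective (ℚᵘ.≃-trans (toℚᵘ-÷ℕ 0 n) (ℚᵘ.*≡* refl))

  ÷ℕ-distribʳ-+ : ∀ m n d → (m ℕ.+ n) ÷ℕ d ≡ m ÷ℕ d + n ÷ℕ d
  ÷ℕ-distribʳ-+ m n zero    = sym (+-identityˡ 0ℚ)
  ÷ℕ-distribʳ-+ m n (suc d) = toℚᵘ-injective (begin-equality
    toℚᵘ ((m ℕ.+ n) ÷ℕ suc d)                  ≃⟨ toℚᵘ-÷ℕ (m ℕ.+ n) d ⟩
    ℚᵘ.mkℚᵘ (+ (m ℕ.+ n)) d                      ≃⟨ ℚᵘ.*≡* cross ⟩
    ℚᵘ.mkℚᵘ (+ m) d ℚᵘ.+ ℚᵘ.mkℚᵘ (+ n) d          ≃⟨ ℚᵘ.+-cong (toℚᵘ-÷ℕ m d) (toℚᵘ-÷ℕ n d) ⟨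
    toℚᵘ (m ÷ℕ suc d) ℚᵘ.+ toℚᵘ (n ÷ℕ suc d)      ≃⟨ toℚᵘ-homo-+ (m ÷ℕ suc d) (n ÷ℕ suc d) ⟨
    toℚᵘ (m ÷ℕ suc d + n ÷ℕ suc d)               ∎)
    where
    open ℚᵘ.≤-Reasoning
    D = suc d
    cross : + (m ℕ.+ n) ℤ.* + (D ℕ.* D) ≡ (+ m ℤ.* + D ℤ.+ + n ℤ.* + D) ℤ.* + D
    cross = trans (cong₂ ℤ._*_ (ℤ.pos-+ m n) (ℤ.pos-* D D)) ([x+y]zz≡[xz+yz]z (+ m) (+ n) (+ D))
      where
      [x+y]zz≡[xz+yz]z : ∀ x y z → (x ℤ.+ y) ℤ.* (z ℤ.* z) ≡ (x ℤ.* z ℤ.+ y ℤ.* z) ℤ.* z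
      [x+y]zz≡[xz+yz]z = solve-∀

  ÷ℕ-* : ∀ m n d e → (m ÷ℕ d) * (n ÷ℕ e) ≡ (m ℕ.* n) ÷ℕ (d ℕ.* e)
  ÷ℕ-* m n zero    e       = *-zeroˡ (n ÷ℕ e)
  ÷ℕ-* m n (suc d) zero    rewrite ℕ.*-zeroʳ d = *-zeroʳ (m ÷ℕ suc d)
  ÷ℕ-* m n (suc d) (suc e) = toℚᵘ-injective (begin-equality
    toℚᵘ (m ÷ℕ suc d * n ÷ℕ suc e)                 ≃⟨ toℚᵘ-homo-* (m ÷ℕ suc d) (n ÷ℕ suc e) ⟩
    toℚᵘ (m ÷ℕ suc d) ℚᵘ.* toℚᵘ (n ÷ℕ suc e)       ≃⟨ ℚᵘ.*-cong (toℚᵘ-÷ℕ m d) (toℚᵘ-÷ℕ n e) ⟩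
    ℚᵘ.mkℚᵘ (+ m ℤ.* + n) (ℕ.pred (suc d ℕ.* suc e))    ≡⟨ cong (λ k → ℚᵘ.mkℚᵘ k _) (ℤ.pos-* m n) ⟨
    ℚᵘ.mkℚᵘ (+ (m ℕ.* n)) (ℕ.pred (suc d ℕ.* suc e))    ≃⟨ toℚᵘ-÷ℕ (m ℕ.* n) _ ⟨
    toℚᵘ ((m ℕ.* n) ÷ℕ (suc d ℕ.* suc e))         ∎)
    where open ℚᵘ.≤-Reasoning

  ÷ℕ-^ℚ : ∀ m d k → (m ÷ℕ d) ^ℚ k ≡ (m ℕ.^ k) ÷ℕ (d ℕ.^ k)
  ÷ℕ-^ℚ m d zero    = refl
  ÷ℕ-^ℚ m d (suc k) = trans (cong ((m ÷ℕ d) *_) (÷ℕ-^ℚ m d k)) (÷ℕ-* m (m ℕ.^ k) d (d ℕ.^ k))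

  sum-÷ℕ-≤ : ∀ q n d (ms : List ℕ) → All (λ m → m ÷ℕ n ≤ q * (1 ÷ℕ d)) ms →
             sum ms ÷ℕ n ≤ q * (length ms ÷ℕ d)
  sum-÷ℕ-≤ q n d []       []         = ≤-reflexive (begin
    0 ÷ℕ n         ≡⟨ 0÷ℕn≡0 n ⟩
    0ℚ             ≡⟨ *-zeroʳ q ⟨
    q * 0ℚ         ≡⟨ cong (q *_) (0÷ℕn≡0 d) ⟨
    q * (0 ÷ℕ d)   ∎)
    where open ≡-Reasoning
  sum-÷ℕ-≤ q n d (m ∷ ms) (m≤ ∷ ms≤) = begin
    (m ℕ.+ sum ms) ÷ℕ n                       ≡⟨ ÷ℕ-distribʳ-+ m (sum ms) n ⟩
    m ÷ℕ n + sum ms ÷ℕ n                      ≤⟨ +-mono-≤ m≤ (sum-÷ℕ-≤ q n d ms ms≤) ⟩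
    q * (1 ÷ℕ d) + q * (length ms ÷ℕ d)       ≡⟨ *-distribˡ-+ q (1 ÷ℕ d) (length ms ÷ℕ d) ⟨
    q * (1 ÷ℕ d + length ms ÷ℕ d)             ≡⟨ cong (q *_) (÷ℕ-distribʳ-+ 1 (length ms) d) ⟨
    q * (suc (length ms) ÷ℕ d)                ∎
    where open ≤-Reasoning


module BinomialBounds where

  open import Data.Nat
  open import Data.Nat.Properties
  open import Data.Nat.Combinatorics using (_C_; _P_; nCk≡nPk/k!; k>n⇒nCk≡0; nPk≡n!/[n∸k]!)
  open import Data.Nat.Combinatorics.Base using (_P′_)
  open import Data.Nat.Combinatorics.Specification using (k!∣nP′k; nP′k≡n!/[n∸k]!)
  open import Data.Nat.DivMod using (m/n*n≡m)
  open import Relation.Nullary using (yes; no)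
  open import Algebra.Properties.CommutativeSemigroup *-commutativeSemigroup using (interchange; xy∙z≈xz∙y)
  open import Relation.Binary.PropositionalEquality
  open import Data.Nat.Combinatorics.Specification using (nCk≡n!/k![n-k]!)
  open import Data.Nat.Combinatorics using (k![n∸k]!∣n!)
  open import Data.Nat.DivMod using (m≥n⇒m/n>0)
  open import Data.Nat.Divisibility using (∣⇒≤)

  [m∸k]*n≤m*[n∸k] : ∀ {m n} k → m ≤ n → (m ∸ k) * n ≤ m * (n ∸ k)
  [m∸k]*n≤m*[n∸k] {m} {n} k m≤n = begin
    (m ∸ k) * n     ≡⟨ *-distribʳ-∸ n m k ⟩
    m * n ∸ k * n   ≤⟨ ∸-monoʳ-≤ (m * n) (*-monoʳ-≤ k m≤n) ⟩
    m * n ∸ k * m   ≡⟨ cong (m * n ∸_) (*-comm k m) ⟩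
    m * n ∸ m * k   ≡⟨ *-distribˡ-∸ m n k ⟨
    m * (n ∸ k)     ∎
    where open ≤-Reasoning

  mP′k*n^k≤m^k*nP′k : ∀ {m n} k → m ≤ n → (m P′ k) * n ^ k ≤ m ^ k * (n P′ k)
  mP′k*n^k≤m^k*nP′k     zero    _   = ≤-refl
  mP′k*n^k≤m^k*nP′k {m} {n} (suc k) m≤n = begin
    (m ∸ k) * (m P′ k) * (n * n ^ k)     ≡⟨ interchange (m ∸ k) (m P′ k) n (n ^ k) ⟩
    (m ∸ k) * n * ((m P′ k) * n ^ k)     ≤⟨ *-mono-≤ ([m∸k]*n≤m*[n∸k] k m≤n) (mP′k*n^k≤m^k*nP′k k m≤n) ⟩
    m * (n ∸ k) * (m ^ k * (n P′ k))     ≡⟨ interchange m (n ∸ k) (m ^ k) (n P′ k) ⟩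
    m * m ^ k * ((n ∸ k) * (n P′ k))     ∎
    where open ≤-Reasoning

  nCk*k!≡nP′k : ∀ {n k} → k ≤ n → (n C k) * k ! ≡ n P′ k
  nCk*k!≡nP′k {n} {k} k≤n = begin
    (n C k) * k !                ≡⟨ cong (_* k !) (nCk≡nPk/k! k≤n) ⟩
    (n P k) / k ! * k !          ≡⟨ cong (λ x → x / k ! * k !) nPk≡nP′k ⟩
    (n P′ k) / k ! * k !         ≡⟨ m/n*n≡m (k!∣nP′k k≤n) ⟩
    n P′ k                       ∎
    where
    open ≡-Reasoning
    instance _ = k !≢0
    nPk≡nP′k : n P k ≡ n P′ k
    nPk≡nP′k = trans (nPk≡n!/[n∸k]! k≤n) (sym (nP′k≡n!/[n∸k]! k≤n))

  mCk*n^k≤m^k*nCk : ∀ {m n} k → m ≤ n → (m C k) * n ^ k ≤ m ^ k * (n C k)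
  mCk*n^k≤m^k*nCk {m} {n} k m≤n with k ≤? m
  ... | no k≰m  = begin
    (m C k) * n ^ k    ≡⟨ cong (_* n ^ k) (k>n⇒nCk≡0 (≰⇒> k≰m)) ⟩
    0                  ≤⟨ z≤n ⟩
    m ^ k * (n C k)    ∎
    where open ≤-Reasoning
  ... | yes k≤m = *-cancelʳ-≤ _ _ (k !) {{k !≢0}} (begin
    (m C k) * n ^ k * k !        ≡⟨ xy∙z≈xz∙y (m C k) (n ^ k) (k !) ⟩
    (m C k) * k ! * n ^ k        ≡⟨ cong (_* n ^ k) (nCk*k!≡nP′k k≤m) ⟩
    (m P′ k) * n ^ k             ≤⟨ mP′k*n^k≤m^k*nP′k k m≤n ⟩
    m ^ k * (n P′ k)             ≡⟨ cong (m ^ k *_) (nCk*k!≡nP′k (≤-trans k≤m m≤n)) ⟨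
    m ^ k * ((n C k) * k !)      ≡⟨ *-assoc (m ^ k) (n C k) (k !) ⟨
    m ^ k * (n C k) * k !        ∎)
    where open ≤-Reasoning

  nCk>0 : ∀ {n k} → k ≤ n → n C k > 0
  nCk>0 {n} {k} k≤n = subst (_> 0) (sym (nCk≡n!/k![n-k]! k≤n))
    (m≥n⇒m/n>0 {{k !* (n ∸ k) !≢0}} (∣⇒≤ {{n !≢0}} (k![n∸k]!∣n! k≤n)))


module SubsetsOfSize where

  open import Data.Nat using (ℕ; zero; suc; _+_)
  open import Data.Nat.Properties using (suc-injective)
  open import Data.Nat.Combinatorics using (_C_; nCk+nC[k+1]≡[n+1]C[k+1])
  open import Data.Fin.Subset using (Subset; _⊆_; ∣_∣; inside; outside)
  open import Data.Fin.Subset.Properties using (out⊆; in⊆in; drop-∷-⊆)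
  open import Data.Vec.Base using ([]; _∷_)
  open Data.Vec.Base._[_]=_ using () renaming (here to zero∈)
  open import Data.List using (List; []; _∷_; map; _++_; length)
  open import Data.List.Properties using (length-map; length-++)
  open import Data.List.Membership.Propositional using () renaming (_∈_ to _∈ₗ_)
  open import Data.List.Membership.Propositional.Properties using (∈-map⁺; ∈-map⁻; ∈-++⁺ˡ; ∈-++⁺ʳ; ∈-++⁻)
  open import Data.List.Relation.Unary.Any using (here)
  open import Data.Product using (_×_; _,_)
  open import Data.Sum using (inj₁; inj₂)
  open import Relation.Binary.PropositionalEquality

  subsets : ∀ {n} → Subset n → ℕ → List (Subset n)
  subsets []            zero    = [] ∷ []
  subsets []            (suc k) = []
  subsets (outside ∷ p) k       = map (outside ∷_) (subsets p k)
  subsets (inside ∷ p)  zero    = map (outside ∷_) (subsets p zero)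
  subsets (inside ∷ p)  (suc k) = map (inside ∷_) (subsets p k) ++ map (outside ∷_) (subsets p (suc k))

  length-subsets : ∀ {n} (p : Subset n) k → length (subsets p k) ≡ ∣ p ∣ C k
  length-subsets []            zero    = refl
  length-subsets []            (suc k) = refl
  length-subsets (outside ∷ p) k       = trans (length-map _ (subsets p k)) (length-subsets p k)
  length-subsets (inside ∷ p)  zero    = trans (length-map _ (subsets p zero)) (length-subsets p zero)
  length-subsets (inside ∷ p)  (suc k) = begin
    length (map (inside ∷_) (subsets p k) ++ map (outside ∷_) (subsets p (suc k)))
      ≡⟨ length-++ (map (inside ∷_) (subsets p k)) ⟩
    length (map (inside ∷_) (subsets p k)) + length (map (outside ∷_) (subsets p (suc k)))
      ≡⟨ cong₂ _+_ (length-map _ (subsets p k)) (length-map _ (subsets p (suc k))) ⟩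
    length (subsets p k) + length (subsets p (suc k))
      ≡⟨ cong₂ _+_ (length-subsets p k) (length-subsets p (suc k)) ⟩
    ∣ p ∣ C k + ∣ p ∣ C suc k
      ≡⟨ nCk+nC[k+1]≡[n+1]C[k+1] ∣ p ∣ k ⟩
    suc ∣ p ∣ C suc k ∎
    where open ≡-Reasoning

  ∈-subsets⁻ : ∀ {n} (p : Subset n) k {q} → q ∈ₗ subsets p k → q ⊆ p × ∣ q ∣ ≡ k
  ∈-subsets⁻ []            zero    (here refl) = (λ x → x) , refl
  ∈-subsets⁻ (outside ∷ p) k       q∈ with ∈-map⁻ _ q∈
  ... | q , q∈′ , refl with ∈-subsets⁻ p k q∈′
  ... | q⊆p , ∣q∣≡k = out⊆ q⊆p , ∣q∣≡k
  ∈-subsets⁻ (inside ∷ p)  zero    q∈ with ∈-map⁻ _ q∈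
  ... | q , q∈′ , refl with ∈-subsets⁻ p zero q∈′
  ... | q⊆p , ∣q∣≡k = out⊆ q⊆p , ∣q∣≡k
  ∈-subsets⁻ (inside ∷ p)  (suc k) q∈ with ∈-++⁻ (map (inside ∷_) (subsets p k)) q∈
  ... | inj₁ q∈ᵢ with ∈-map⁻ _ q∈ᵢ
  ...   | q , q∈′ , refl with ∈-subsets⁻ p k q∈′
  ...     | q⊆p , ∣q∣≡k = in⊆in q⊆p , cong suc ∣q∣≡k
  ∈-subsets⁻ (inside ∷ p)  (suc k) q∈ | inj₂ q∈ₒ with ∈-map⁻ _ q∈ₒ
  ...   | q , q∈′ , refl with ∈-subsets⁻ p (suc k) q∈′
  ...     | q⊆p , ∣q∣≡k = out⊆ q⊆p , ∣q∣≡k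

  ∈-subsets⁺ : ∀ {n} (p : Subset n) k {q} → q ⊆ p → ∣ q ∣ ≡ k → q ∈ₗ subsets p k
  ∈-subsets⁺ []            zero    {[]}          _   _     = here refl
  ∈-subsets⁺ (outside ∷ p) k       {inside ∷ q}  q⊆p _     with q⊆p zero∈
  ... | ()
  ∈-subsets⁺ (outside ∷ p) k       {outside ∷ q} q⊆p ∣q∣≡k =
    ∈-map⁺ _ (∈-subsets⁺ p k (drop-∷-⊆ q⊆p) ∣q∣≡k)
  ∈-subsets⁺ (inside ∷ p)  zero    {outside ∷ q} q⊆p ∣q∣≡0 =
    ∈-map⁺ _ (∈-subsets⁺ p zero (drop-∷-⊆ q⊆p) ∣q∣≡0)
  ∈-subsets⁺ (inside ∷ p)  (suc k) {inside ∷ q}  q⊆p ∣q∣≡k =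
    ∈-++⁺ˡ (∈-map⁺ _ (∈-subsets⁺ p k (drop-∷-⊆ q⊆p) (suc-injective ∣q∣≡k)))
  ∈-subsets⁺ (inside ∷ p)  (suc k) {outside ∷ q} q⊆p ∣q∣≡k =
    ∈-++⁺ʳ (map (inside ∷_) (subsets p k)) (∈-map⁺ _ (∈-subsets⁺ p (suc k) (drop-∷-⊆ q⊆p) ∣q∣≡k))


module Counting where

  open import Defs
  open import Data.Bool using (Bool; true; false; _∨_)
  import Data.Bool as Bool
  open import Data.Nat using (_≤_; _+_; z≤n; s≤s)
  open import Data.Nat.Properties using (≤-trans; ≤-reflexive; +-suc; +-monoʳ-≤; n≤1+n)
  open import Data.Nat.ListAction using (sum)
  open import Data.List using (List; []; _∷_; map)
  open import Data.Bool.ListAction using (any)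
  open import Data.Bool.Properties using (∨-zeroʳ)
  open import Data.List.Relation.Binary.Sublist.Propositional using (⊆-refl)
  open import Data.List.Relation.Binary.Sublist.Propositional.Properties using (filter⁺; length-mono-≤)
  open import Data.List.Membership.Propositional using () renaming (_∈_ to _∈ₗ_)
  open import Data.List.Relation.Unary.Any using (here; there)
  open import Data.Product using (∃; _×_; _,_)
  open import Relation.Binary.PropositionalEquality

  countH-mono : ∀ {N} {E F : Hash N → Bool} (H : Family N) →
                (∀ {h} → E h ≡ true → F h ≡ true) → countH E H ≤ countH F H
  countH-mono {E = E} {F} H E⇒F =
    length-mono-≤ (filter⁺ (λ h → E h Bool.≟ true) (λ h → F h Bool.≟ true) (λ { refl → E⇒F }) (⊆-refl {x = H}))

  countH-∨ : ∀ {N} (E F : Hash N → Bool) (H : Family N) →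
             countH (λ h → E h ∨ F h) H ≤ countH E H + countH F H
  countH-∨ E F []      = z≤n
  countH-∨ E F (h ∷ H) with E h | F h
  ... | true  | true  = s≤s (≤-trans (countH-∨ E F H) (+-monoʳ-≤ (countH E H) (n≤1+n (countH F H))))
  ... | true  | false = s≤s (countH-∨ E F H)
  ... | false | true  = ≤-trans (s≤s (countH-∨ E F H)) (≤-reflexive (sym (+-suc (countH E H) (countH F H))))
  ... | false | false = countH-∨ E F H

  countH-false : ∀ {N} (H : Family N) → countH (λ _ → false) H ≡ 0
  countH-false []      = refl
  countH-false (_ ∷ H) = countH-false H

  countH-any≤sum : ∀ {N} {S : Set} (E : S → Hash N → Bool) (xs : List S) (H : Family N) →
                   countH (λ h → any (λ X → E X h) xs) H ≤ sum (map (λ X → countH (E X) H) xs)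
  countH-any≤sum E []       H = ≤-reflexive (countH-false H)
  countH-any≤sum E (X ∷ xs) H =
    ≤-trans (countH-∨ (E X) (λ h → any (λ Y → E Y h) xs) H) (+-monoʳ-≤ (countH (E X) H) (countH-any≤sum E xs H))

  any-∈ : ∀ {A : Set} (p : A → Bool) {x xs} → x ∈ₗ xs → p x ≡ true → any p xs ≡ true
  any-∈ p {xs = _ ∷ ys} (here refl) px = cong (_∨ any p ys) px
  any-∈ p {xs = y ∷ _} (there x∈) px = trans (cong (p y ∨_) (any-∈ p x∈ px)) (∨-zeroʳ (p y))

  countH-union-bound : ∀ {N} {S : Set} (F : Hash N → Bool) (E : S → Hash N → Bool) (xs : List S) (H : Family N) →
                       (∀ {h} → F h ≡ true → ∃ λ X → X ∈ₗ xs × E X h ≡ true) →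
                       countH F H ≤ sum (map (λ X → countH (E X) H) xs)
  countH-union-bound F E xs H cover = ≤-trans
    (countH-mono H (λ Fh → let X , X∈ , EXh = cover Fh in any-∈ (λ Y → E Y _) X∈ EXh))
    (countH-any≤sum E xs H)


module SubsetFacts where

  open import Defs
  open import Data.Bool using (Bool; T)
  open import Data.Bool.Properties using (T-∧)
  open import Data.Nat as ℕ using (ℕ; zero; suc; _<_; _≤_; s≤s)
  import Data.Nat.Properties as ℕ
  open import Data.Fin using (Fin)
  import Data.Fin as Fin
  open import Data.Fin.Properties using (any?)
  open import Data.Fin.Subset using (Subset; _⊆_; ∣_∣; _∈_; _∉_; inside; outside; _─_; _∪_; ⁅_⁆)
  open import Data.Fin.Subset.Properties using (_∈?_; p⊆q⇒∣p∣≤∣q∣; ∪-identityʳ; drop-there; ∣p∣≤∣x∷p∣)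
  open import Data.Vec.Base using ([]; _∷_; _[_]=_)
  open _[_]=_ using () renaming (here to zero∈; there to suc∈)
  open import Data.List using ([]; _∷_; filter; length; allFin; tabulate)
  open import Data.List.Membership.Propositional using () renaming (_∈_ to _∈ₗ_)
  open import Data.List.Membership.Propositional.Properties using (∈-filter⁺; ∈-filter⁻; ∈-allFin)
  open import Data.List.Relation.Unary.All using (All; []; _∷_)
  open import Data.Product using (∃; _×_; _,_; proj₂)
  open import Function using (_∘_; _⇔_; mk⇔; Equivalence)
  open import Relation.Binary.PropositionalEquality
  open import Relation.Nullary using (yes; no; contradiction)
  open import Relation.Nullary.Decidable using (_×-dec_; ¬?; decidable-stable)
  open import Relation.Unary using (Pred; Decidable)
  open Equivalence using (to; from)

  T-all : ∀ {a} {A : Set a} (p : A → Bool) xs → T (all p xs) ⇔ All (T ∘ p) xs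
  T-all p []       = mk⇔ (λ _ → []) (λ _ → _)
  T-all p (x ∷ xs) = mk⇔
    (λ t → let px , pxs = to T-∧ t in px ∷ to (T-all p xs) pxs)
    (λ { (px ∷ pxs) → from T-∧ (px , from (T-all p xs) pxs) })

  ∈-members : ∀ {n} {p : Subset n} {x} → x ∈ₗ members p ⇔ x ∈ p
  ∈-members {n} {p} {x} = mk⇔ (proj₂ ∘ ∈-filter⁻ (_∈? p) {xs = allFin n}) (∈-filter⁺ (_∈? p) (∈-allFin x))

  x∈p─q⇒x∉q : ∀ {n} (p q : Subset n) {x} → x ∈ p ─ q → x ∉ q
  x∈p─q⇒x∉q (_ ∷ p)       (_ ∷ q)       (suc∈ x∈) (suc∈ x∈q) = x∈p─q⇒x∉q p q x∈ x∈q

  ∣p∪⁅x⁆∣≡1+∣p∣ : ∀ {n} {p : Subset n} {x} → x ∉ p → ∣ p ∪ ⁅ x ⁆ ∣ ≡ suc ∣ p ∣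
  ∣p∪⁅x⁆∣≡1+∣p∣ {p = inside  ∷ p} {Fin.zero}  x∉p = contradiction zero∈ x∉p
  ∣p∪⁅x⁆∣≡1+∣p∣ {p = outside ∷ p} {Fin.zero}  _   = cong (suc ∘ ∣_∣) (∪-identityʳ p)
  ∣p∪⁅x⁆∣≡1+∣p∣ {p = inside  ∷ p} {Fin.suc x} x∉p = cong suc (∣p∪⁅x⁆∣≡1+∣p∣ (x∉p ∘ suc∈))
  ∣p∪⁅x⁆∣≡1+∣p∣ {p = outside ∷ p} {Fin.suc x} x∉p = ∣p∪⁅x⁆∣≡1+∣p∣ (x∉p ∘ suc∈)

  ∃-∈-∉ : ∀ {n} {p q : Subset n} → ∣ q ∣ < ∣ p ∣ → ∃ λ x → x ∈ p × x ∉ q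
  ∃-∈-∉ {p = p} {q} ∣q∣<∣p∣ with any? (λ x → x ∈? p ×-dec ¬? (x ∈? q))
  ... | yes found = found
  ... | no  none  = contradiction (p⊆q⇒∣p∣≤∣q∣ p⊆q) (ℕ.<⇒≱ ∣q∣<∣p∣)
    where
    p⊆q : p ⊆ q
    p⊆q {x} x∈p = decidable-stable (x ∈? q) (λ x∉q → none (x , x∈p , x∉q))

  -- rank counts along members A = filter (_∈? A) (tabulate id); the induction needs
  -- an arbitrary f in place of id.
  length-filter-filter-tabulate :
    ∀ {a ℓ₁ ℓ₂} {A : Set a} {P : Pred A ℓ₁} {Q : Pred A ℓ₂} (P? : Decidable P) (Q? : Decidable Q)
    {n} (f : Fin n → A) (p : Subset n) →
    (∀ i → Q (f i) → P (f i) → i ∈ p) → length (filter P? (filter Q? (tabulate f))) ≤ ∣ p ∣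
  length-filter-filter-tabulate P? Q? {zero}  f []      _     = ℕ.z≤n
  length-filter-filter-tabulate P? Q? {suc n} f (s ∷ p) QP⇒∈
    with rest ← length-filter-filter-tabulate P? Q? (f ∘ Fin.suc) p (λ i q → drop-there ∘ QP⇒∈ (Fin.suc i) q)
       | Q? (f Fin.zero)
  ... | no _    = ℕ.≤-trans rest (∣p∣≤∣x∷p∣ s p)
  ... | yes Qf₀ with P? (f Fin.zero)
  ...   | no _    = ℕ.≤-trans rest (∣p∣≤∣x∷p∣ s p)
  ...   | yes Pf₀ with QP⇒∈ Fin.zero Qf₀ Pf₀
  ...     | zero∈ = s≤s rest


module LexicographicOrder where

  open import Defs
  open import Data.Bool using (T; true; _≟_)
  open import Data.Bool.Properties using (T-≡; T-∧; T-∨)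
  open import Data.Nat as ℕ using (ℕ; zero; suc; _<_; _≤_)
  import Data.Nat.Properties as ℕ
  open import Data.Fin using (toℕ)
  open import Data.Fin.Subset using (Subset; _⊆_; ∣_∣; _∈_; _─_; _∪_; ⁅_⁆; _-_) renaming (⊥ to ∅)
  open import Data.Fin.Subset.Properties
    using (_∈?_; p─q⊆p; x∈p∧x∉q⇒x∈p─q; x∈p∪q⁺; x∈p∪q⁻; x∈⁅y⁆⇒x≡y; ∉⊥; ∣⊥∣≡0; x∈p∧x≢y⇒x∈p-y; x∈p⇒∣p-x∣<∣p∣)
  open import Data.List using ([]; _∷_)
  open import Data.List.Membership.Propositional using () renaming (_∈_ to _∈ₗ_)
  open import Data.List.Relation.Unary.Any using (here; there)
  import Data.List.Relation.Unary.All as All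
  open import Data.Product using (∃; _×_; _,_)
  open import Data.Product.Relation.Binary.Lex.Strict using (×-strictTotalOrder)
  open import Data.Sum using (inj₁; inj₂)
  import Data.Sum as Sum
  import Data.Product as Product
  open import Function using (_∘_; Equivalence)
  open import Relation.Binary using (StrictTotalOrder)
  import Relation.Binary.Construct.On as On
  open import Relation.Binary.PropositionalEquality
  open import Relation.Nullary using (yes; no; ¬_; contradiction)
  open import Relation.Nullary.Decidable using (decidable-stable; dec-false)
  open import Data.Empty using (⊥-elim)
  open Equivalence using (to; from)
  open SubsetFacts

  module _ {a ℓ₁ ℓ₂} (O : StrictTotalOrder a ℓ₁ ℓ₂) where
    open StrictTotalOrder O using (module Eq; irrefl; _<?_) renaming (_<_ to _⊏_; trans to ⊏-trans)

    ∃-minimal : ∀ {x xs} → x ∈ₗ xs → ∃ λ m → m ∈ₗ xs × (∀ {y} → y ∈ₗ xs → ¬ y ⊏ m)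
    ∃-minimal {xs = x ∷ []}      _ = x , here refl , λ { (here refl) → irrefl Eq.refl }
    ∃-minimal {xs = x ∷ x′ ∷ xs} _ with ∃-minimal {xs = x′ ∷ xs} (here refl)
    ... | m , m∈ , m-min with x <? m
    ...   | yes x⊏m = x , here refl , λ { (here refl) → irrefl Eq.refl
                                        ; (there y∈) y⊏x → m-min y∈ (⊏-trans y⊏x x⊏m) }
    ...   | no  x⋢m = m , there m∈ , λ { (here refl) → x⋢m ; (there y∈) → m-min y∈ }

  module _ {N} (h : Hash N) where

    -- y ≺ x unfolds to h y < h x ⊎ (h y ≡ h x × toℕ y < toℕ x), the order of the pairs (h(x), x).
    lexOrder : StrictTotalOrder _ _ _
    lexOrder = On.strictTotalOrder (×-strictTotalOrder ℕ.<-strictTotalOrder ℕ.<-strictTotalOrder) (λ x → h x , toℕ x)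

    open StrictTotalOrder lexOrder using (module Eq; irrefl) renaming (_<_ to _≺_)

    lexLt⇒≺ : ∀ {y x} → lexLt h y x ≡ true → y ≺ x
    lexLt⇒≺ = Sum.map (ℕ.<ᵇ⇒< _ _) (Product.map (ℕ.≡ᵇ⇒≡ _ _) (ℕ.<ᵇ⇒< _ _) ∘ to T-∧) ∘ to T-∨ ∘ from T-≡

    module _ (A : Subset N) where

      IsInitialSegment : Subset N → Set
      IsInitialSegment X = X ⊆ A × (∀ {x y} → x ∈ X → y ∈ A → y ≺ x → y ∈ X)

      initialSegment-extend : ∀ {X} → IsInitialSegment X → ∣ X ∣ < ∣ A ∣ →
                              ∃ λ X′ → IsInitialSegment X′ × ∣ X′ ∣ ≡ suc ∣ X ∣
      initialSegment-extend {X} (X⊆A , closed) ∣X∣<∣A∣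
        with x , x∈A , x∉X ← ∃-∈-∉ ∣X∣<∣A∣
        with m , m∈ , m-minimal ← ∃-minimal lexOrder (from ∈-members (x∈p∧x∉q⇒x∈p─q x∈A x∉X))
        = X ∪ ⁅ m ⁆ , (X∪m⊆A , closed′) , ∣p∪⁅x⁆∣≡1+∣p∣ (x∈p─q⇒x∉q A X m∈A─X)
        where
        m∈A─X : m ∈ A ─ X
        m∈A─X = to ∈-members m∈
        X∪m⊆A : X ∪ ⁅ m ⁆ ⊆ A
        X∪m⊆A y∈ with x∈p∪q⁻ X ⁅ m ⁆ y∈
        ... | inj₁ y∈X = X⊆A y∈X
        ... | inj₂ y∈m rewrite x∈⁅y⁆⇒x≡y m y∈m = p─q⊆p A X m∈A─X
        closed′ : ∀ {y z} → y ∈ X ∪ ⁅ m ⁆ → z ∈ A → z ≺ y → z ∈ X ∪ ⁅ m ⁆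
        closed′ {y} {z} y∈ z∈A z≺y with x∈p∪q⁻ X ⁅ m ⁆ y∈
        ... | inj₁ y∈X = x∈p∪q⁺ (inj₁ (closed y∈X z∈A z≺y))
        ... | inj₂ y∈m rewrite x∈⁅y⁆⇒x≡y m y∈m = x∈p∪q⁺ (inj₁ (decidable-stable (z ∈? X)
              λ z∉X → m-minimal (from ∈-members (x∈p∧x∉q⇒x∈p─q z∈A z∉X)) z≺y))

      ∃-initialSegment : ∀ k → k ≤ ∣ A ∣ → ∃ λ X → IsInitialSegment X × ∣ X ∣ ≡ k
      ∃-initialSegment zero    _   = ∅ , ((⊥-elim ∘ ∉⊥) , (⊥-elim ∘ ∉⊥)) , ∣⊥∣≡0 N
      ∃-initialSegment (suc k) k<∣A∣ with ∃-initialSegment k (ℕ.<⇒≤ k<∣A∣)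
      ... | X , initial , refl = initialSegment-extend initial k<∣A∣

      rank<∣∣ : ∀ {X x} → IsInitialSegment X → x ∈ X → rank h A x < ∣ X ∣
      rank<∣∣ {X} {x} (_ , closed) x∈X = ℕ.≤-<-trans rank≤∣X-x∣ (x∈p⇒∣p-x∣<∣p∣ x∈X)
        where
        rank≤∣X-x∣ : rank h A x ≤ ∣ X - x ∣
        rank≤∣X-x∣ = length-filter-filter-tabulate (λ y → lexLt h y x ≟ true) (_∈? A) (λ y → y) (X - x)
          λ y y∈A y<x → x∈p∧x≢y⇒x∈p-y (closed x∈X y∈A (lexLt⇒≺ y<x)) λ { refl → irrefl Eq.refl (lexLt⇒≺ y<x) }

      initialSegment⇒maxLeMin : ∀ {X} → IsInitialSegment X → maxLeMin h A X ≡ true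
      initialSegment⇒maxLeMin {X} (_ , closed) = to T-≡ (from (T-all _ (members X)) (All.tabulate λ {x} x∈X →
        from (T-all _ (members (A ─ X))) (All.tabulate λ {y} y∈A─X →
          ℕ.≤⇒≤ᵇ (ℕ.≮⇒≥ λ hy<hx → x∈p─q⇒x∉q A X (to ∈-members y∈A─X)
            (closed (to ∈-members x∈X) (p─q⊆p A X (to ∈-members y∈A─X)) (inj₁ hy<hx))))))

      smallestIn⇒∃maxLeMin : ∀ {C ℓ} → ℓ ≤ ∣ A ∣ → smallestIn h A C ℓ ≡ true →
                             ∃ λ X → X ⊆ C × ∣ X ∣ ≡ ℓ × maxLeMin h A X ≡ true
      smallestIn⇒∃maxLeMin {C} {ℓ} ℓ≤∣A∣ smallest with ∃-initialSegment ℓ ℓ≤∣A∣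
      ... | X , initial@(X⊆A , _) , refl = X , X⊆C , refl , initialSegment⇒maxLeMin initial
        where
        X⊆C : X ⊆ C
        X⊆C {x} x∈X with to T-∨ (All.lookup (to (T-all _ (members A)) (from T-≡ smallest)) (from ∈-members (X⊆A x∈X)))
        ... | inj₁ ℓ≤rank = contradiction (ℕ.≤ᵇ⇒≤ _ _ ℓ≤rank) (ℕ.<⇒≱ (rank<∣∣ initial x∈X))
        ... | inj₂ x∈?C   = decidable-stable (x ∈? C) (λ x∉C → subst T (dec-false (x ∈? C) x∉C) x∈?C)

open import Defs
open import Data.Nat using (ℕ; _≤_; _≥_)
open import Data.Nat.Combinatorics using () renaming (_C_ to _choose_)
open import Data.Fin.Subset using (Subset; _⊆_; ∣_∣)
open import Data.List using (List; [])
open import Data.Product using (_×_)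
open import Relation.Binary.PropositionalEquality using (_≡_; _≢_)
open import Data.Rational using (ℚ; 0ℚ; 1ℚ; _+_; _-_; _*_) renaming (_<_ to _<ℚ_; _≤_ to _≤ℚ_)

import Data.Nat as ℕ
import Data.Nat.Properties as ℕ
open import Data.Nat.ListAction using (sum)
open import Data.Fin.Subset.Properties using (p⊆q⇒∣p∣≤∣q∣)
open import Data.List using (map; length)
open import Data.List.Properties using (length-map)
import Data.List.Relation.Unary.All as All
open import Data.List.Relation.Unary.All.Properties using (map⁺)
open import Data.Product using (∃; _,_; proj₂)
open import Data.Rational using (NonNegative; nonNegative)
open import Data.Rational.Properties using (module ≤-Reasoning; *-monoˡ-≤-nonNeg; nonNeg+nonNeg⇒nonNeg; <⇒≤)
open import Function using (_∘_)
open import Data.Bool using (Bool; true)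
open import Data.List.Membership.Propositional using () renaming (_∈_ to _∈ₗ_)
open import Relation.Binary.PropositionalEquality using (cong; trans)

open NaturalQuotients
open BinomialBounds
open SubsetsOfSize
open Counting
open LexicographicOrder

lemma4p6 : (N ℓ : ℕ) (ε : ℚ) (H : Family N) →
    0ℚ <ℚ ε → ε <ℚ 1ℚ → 2 ≤ ℓ → ℓ ≤ N → H ≢ [] →
    ((A X : Subset N) → X ⊆ A → ∣ X ∣ ≡ ℓ →
      ((1ℚ - ε) * (1 ÷ℕ (∣ A ∣ choose ℓ)) ≤ℚ Pr H (λ h → maxLeMin h A X))
      × (Pr H (λ h → maxLeMin h A X) ≤ℚ (1ℚ + ε) * (1 ÷ℕ (∣ A ∣ choose ℓ)))) →
    (A C : Subset N) → ∣ A ∣ ≥ ℓ → C ⊆ A →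
    Pr H (λ h → smallestIn h A C ℓ) ≤ℚ (1ℚ + ε) * ((∣ C ∣ ÷ℕ ∣ A ∣) ^ℚ ℓ)
lemma4p6 N ℓ ε H 0<ε _ 2≤ℓ _ _ minwise A C ℓ≤∣A∣ C⊆A = begin
  Pr H (λ h → smallestIn h A C ℓ)
    ≤⟨ ÷ℕ-monoˡ-≤ (length H) (countH-union-bound (λ h → smallestIn h A C ℓ) E Xs H (λ {h} → smallest⇒covered {h})) ⟩
  sum (map (λ X → countH (E X) H) Xs) ÷ℕ length H
    ≤⟨ sum-÷ℕ-≤ (1ℚ + ε) (length H) (∣ A ∣ choose ℓ) _ (map⁺ (All.tabulate each-bound)) ⟩
  (1ℚ + ε) * (length (map (λ X → countH (E X) H) Xs) ÷ℕ (∣ A ∣ choose ℓ))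
    ≡⟨ cong (λ k → (1ℚ + ε) * (k ÷ℕ (∣ A ∣ choose ℓ))) (trans (length-map _ Xs) (length-subsets C ℓ)) ⟩
  (1ℚ + ε) * ((∣ C ∣ choose ℓ) ÷ℕ (∣ A ∣ choose ℓ))
    ≤⟨ *-monoˡ-≤-nonNeg (1ℚ + ε) (÷ℕ-≤-cross (mCk*n^k≤m^k*nCk ℓ (p⊆q⇒∣p∣≤∣q∣ C⊆A))) ⟩
  (1ℚ + ε) * ((∣ C ∣ ℕ.^ ℓ) ÷ℕ (∣ A ∣ ℕ.^ ℓ))
    ≡⟨ cong ((1ℚ + ε) *_) (÷ℕ-^ℚ ∣ C ∣ ∣ A ∣ ℓ) ⟨
  (1ℚ + ε) * ((∣ C ∣ ÷ℕ ∣ A ∣) ^ℚ ℓ) ∎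
  where
  open ≤-Reasoning
  E : Subset N → Hash N → Bool
  E X h = maxLeMin h A X
  Xs : List (Subset N)
  Xs = subsets C ℓ
  instance
    ∣A∣Cℓ≢0 : ℕ.NonZero (∣ A ∣ choose ℓ)
    ∣A∣Cℓ≢0 = ℕ.>-nonZero (nCk>0 ℓ≤∣A∣)
    ∣A∣^ℓ≢0 : ℕ.NonZero (∣ A ∣ ℕ.^ ℓ)
    ∣A∣^ℓ≢0 = ℕ.m^n≢0 ∣ A ∣ ℓ {{ℕ.>-nonZero (ℕ.<-≤-trans (ℕ.s≤s ℕ.z≤n) (ℕ.≤-trans 2≤ℓ ℓ≤∣A∣))}}
    1+ε≥0 : NonNegative (1ℚ + ε)
    1+ε≥0 = nonNeg+nonNeg⇒nonNeg 1ℚ ε {{nonNegative (<⇒≤ 0<ε)}}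
  smallest⇒covered : ∀ {h} → smallestIn h A C ℓ ≡ true → ∃ λ X → X ∈ₗ Xs × E X h ≡ true
  smallest⇒covered {h} smallest with smallestIn⇒∃maxLeMin h A ℓ≤∣A∣ smallest
  ... | X , X⊆C , ∣X∣≡ℓ , maxLeMin≡true = X , ∈-subsets⁺ C ℓ X⊆C ∣X∣≡ℓ , maxLeMin≡true
  each-bound : ∀ {X} → X ∈ₗ Xs → countH (E X) H ÷ℕ length H ≤ℚ (1ℚ + ε) * (1 ÷ℕ (∣ A ∣ choose ℓ))
  each-bound X∈ with ∈-subsets⁻ C ℓ X∈
  ... | X⊆C , ∣X∣≡ℓ = proj₂ (minwise A _ (C⊆A ∘ X⊆C) ∣X∣≡ℓ)
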